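{- Let $n>k$ be positive integers with both $n$ and $k$ even. Then $\mathrm{msum}(n,k)=1$.
   Context: $S_n$ denotes the set of permutations $\pi=(\pi_1,\ldots,\pi_n)$ of $1,\ldots,n$, with indices taken cyclically: $\pi_{n+i}=\pi_i$. For $\pi\in S_n$ let $s_i=\sum_{j=0}^{k-1}\pi_{i+j}$ for $i=1,\ldots,n$. Define $\mathrm{msum}(\pi,k)=\max\{s_i: 1\le i\le n\}-\frac{k(n+1)}{2}$ and $\mathrm{msum}(n,k)=\min\{\mathrm{msum}(\pi,k):\pi\in S_n\}$. -}

module Defs where

open import Data.Nat using (ℕ; zero; suc; _+_; _*_; _⊔_)
open import Data.Nat.DivMod using (_mod_)
open import Data.Fin using (Fin; toℕ)
open import Data.Fin.Permutation using (Permutation′; _⟨$⟩ʳ_)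
open import Data.List using (List; map; foldr; upTo)
open import Data.Nat.ListAction using (sum)
open import Data.Integer using (+_)
open import Data.Rational using (ℚ; _-_; _/_)

-- The permutation π ∈ S_n is a bijection Fin n → Fin n; the value
-- π_i (1-based, with cyclic index i) is  toℕ (π (i mod n)) + 1.
-- Indices here are 0-based: position i ∈ {0,…,n-1} corresponds to the
-- paper's index i+1.
val : (n : ℕ) → Permutation′ n → ℕ → ℕ
val zero    π i = 0
val (suc m) π i = suc (toℕ (π ⟨$⟩ʳ (i mod suc m)))

windowSum : (n k : ℕ) → Permutation′ n → ℕ → ℕ
windowSum n k π i = sum (map (λ j → val n π (i + j)) (upTo k))

-- max { s_i : i = 1,…,n }   (all s_i ≥ 0, so 0 is a neutral start)
maxWindow : (n k : ℕ) → Permutation′ n → ℕ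
maxWindow n k π = foldr _⊔_ 0 (map (windowSum n k π) (upTo n))

msumπ : (n k : ℕ) → Permutation′ n → ℚ
msumπ n k π = ((+ maxWindow n k π) / 1) - ((+ (k * (n + 1))) / 2)

open import Data.Product using (Σ; _×_)
open import Relation.Binary.PropositionalEquality using (_≡_)
import Data.Rational as Q

MsumEq : (n k : ℕ) → ℚ → Set
MsumEq n k q = Σ (Permutation′ n) (λ π → msumπ n k π ≡ q)
             × ((π : Permutation′ n) → q Q.≤ msumπ n k π)

module Submission where

-- msum(n,k) = 1 for even n > k > 0.  Write n = 2m, k = 2d; the average
-- window sum is T = k(n+1)/2 = d(n+1).
--
-- Lower bound (any 0 < k < n): the n cyclic windows total nT, since every
-- value lies in k of them.  If no window exceeded T all would equal T, and
-- two consecutive windows would give π_k = π_0.  So max_i s_i ≥ T + 1.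
--
-- Upper bound: if the pairs (π_{2J}, π_{2J+1}) all sum to n+1 then windows
-- at even positions sum to T and the window at 2J+1 to T + π_{2J+2d} − π_{2J},
-- so π_{2(J+d)} ≤ π_{2J} + 1 suffices.  With g = gcd(m,d), L = m/g, the map
-- φ(w) = (⌊w/L⌋ + w·d) mod m is injective on {0,…,m−1} and shifts by d along
-- a successor w⁺ ≤ w + 1.  Placing w+1 at position 2φ(w) and n−w at 2φ(w)+1
-- (a permutation, by pigeonhole) meets both conditions.

open import Defs
open import Data.Nat using (ℕ; _<_)
open import Data.Nat.Divisibility using (_∣_)
open import Data.Rational using (1ℚ)

open import Data.Nat hiding (_<_; _/_)
open import Data.Nat.Properties
open import Data.Nat.DivMod
open import Data.Nat.Divisibility using (divides; ∣-trans; ∣m+n∣m⇒∣n; n∣m*n; *-cancelʳ-∣; ∣⇒≤)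
open import Data.Nat.GCD using (gcd; gcd[m,n]∣m; gcd[m,n]∣n; gcd[m,n]≢0)
open import Data.Nat.Coprimality using (Coprime; coprime-/gcd; coprime-divisor)
open import Data.Nat.Tactic.RingSolver using (solve-∀)
open import Data.Fin as Fin using (Fin; toℕ)
import Data.Fin.Properties as FinP
open import Data.Fin.Permutation using (Permutation′; _⟨$⟩ʳ_; _⟨$⟩ˡ_; inverseˡ; permutation)
open import Data.List using (map; foldr; applyUpTo)
open import Data.Nat.ListAction using (sum)
import Algebra.Properties.CommutativeMonoid.Sum as MonoidSum
open import Data.Empty using (⊥-elim)
open import Data.Sum using (_⊎_; inj₁; inj₂)
open import Data.Product using (Σ; ∃; _×_; _,_; proj₁; proj₂)
open import Relation.Nullary using (¬_; yes; no)
open import Function using (_∘_; id)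
open import Relation.Binary.PropositionalEquality
import Data.Integer as ℤ
import Data.Integer.Properties as ℤP
import Data.Integer.Tactic.RingSolver as ℤSolver
import Data.Rational as ℚ
import Data.Rational.Properties as ℚP
open import Data.Rational.Unnormalised as ℚᵘ using (mkℚᵘ)
import Data.Rational.Unnormalised.Properties as ℚᵘP

sumTo : (ℕ → ℕ) → ℕ → ℕ
sumTo h zero    = 0
sumTo h (suc k) = h 0 + sumTo (h ∘ suc) k

maxTo : (ℕ → ℕ) → ℕ → ℕ
maxTo h zero    = 0
maxTo h (suc k) = h 0 ⊔ maxTo (h ∘ suc) k

sum-applyUpTo : ∀ (f g : ℕ → ℕ) k → sum (map f (applyUpTo g k)) ≡ sumTo (f ∘ g) k
sum-applyUpTo f g zero    = refl
sum-applyUpTo f g (suc k) = cong (f (g 0) +_) (sum-applyUpTo f (g ∘ suc) k)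

max-applyUpTo : ∀ (f g : ℕ → ℕ) k → foldr _⊔_ 0 (map f (applyUpTo g k)) ≡ maxTo (f ∘ g) k
max-applyUpTo f g zero    = refl
max-applyUpTo f g (suc k) = cong (f (g 0) ⊔_) (max-applyUpTo f (g ∘ suc) k)

sumTo-cong : ∀ {f g : ℕ → ℕ} k → (∀ i → i < k → f i ≡ g i) → sumTo f k ≡ sumTo g k
sumTo-cong zero    f≡g = refl
sumTo-cong (suc k) f≡g = cong₂ _+_ (f≡g 0 (s≤s z≤n)) (sumTo-cong k (λ i i<k → f≡g (suc i) (s≤s i<k)))

sumTo-snoc : ∀ (f : ℕ → ℕ) k → sumTo f (suc k) ≡ sumTo f k + f k
sumTo-snoc f zero    = +-comm (f 0) 0
sumTo-snoc f (suc k) = trans (cong (f 0 +_) (sumTo-snoc (f ∘ suc) k)) (sym (+-assoc (f 0) _ _))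

sumTo-+ : ∀ (f g : ℕ → ℕ) k → sumTo (λ i → f i + g i) k ≡ sumTo f k + sumTo g k
sumTo-+ f g zero    = refl
sumTo-+ f g (suc k) =
  trans (cong (f 0 + g 0 +_) (sumTo-+ (f ∘ suc) (g ∘ suc) k))
        (interchange (f 0) (g 0) (sumTo (f ∘ suc) k) (sumTo (g ∘ suc) k))
  where
  interchange : ∀ a b c d → a + b + (c + d) ≡ a + c + (b + d)
  interchange = solve-∀

sumTo-const : ∀ c k → sumTo (λ _ → c) k ≡ k * c
sumTo-const c zero    = refl
sumTo-const c (suc k) = cong (c +_) (sumTo-const c k)

sumTo-swap : ∀ (F : ℕ → ℕ → ℕ) n k →
             sumTo (λ i → sumTo (F i) k) n ≡ sumTo (λ j → sumTo (λ i → F i j) n) k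
sumTo-swap F zero    k = sym (trans (sumTo-const 0 k) (*-zeroʳ k))
sumTo-swap F (suc n) k =
  trans (cong (sumTo (F 0) k +_) (sumTo-swap (F ∘ suc) n k))
        (sym (sumTo-+ (F 0) (λ j → sumTo (λ i → F (suc i) j) n) k))

sumTo-periodic : ∀ (A : ℕ → ℕ) n → (∀ x → A (x + n) ≡ A x) →
                 ∀ j → sumTo (λ i → A (i + j)) n ≡ sumTo A n
sumTo-periodic A n per zero    = sumTo-cong n (λ i _ → cong A (+-identityʳ i))
sumTo-periodic A n per (suc j) = begin
    sumTo (λ i → A (i + suc j)) n ≡⟨ sumTo-cong n (λ i _ → cong A (+-suc i j)) ⟩
    sumTo (h ∘ suc) n             ≡⟨ rotate ⟩
    sumTo h n                     ≡⟨ sumTo-periodic A n per j ⟩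
    sumTo A n                     ∎
  where
  open ≡-Reasoning
  h : ℕ → ℕ
  h i = A (i + j)
  rotate : sumTo (h ∘ suc) n ≡ sumTo h n
  rotate = +-cancelˡ-≡ (h 0) _ _ (begin
    sumTo h (suc n)   ≡⟨ sumTo-snoc h n ⟩
    sumTo h n + h n   ≡⟨ cong (sumTo h n +_) (trans (cong A (+-comm n j)) (per j)) ⟩
    sumTo h n + h 0   ≡⟨ +-comm (sumTo h n) (h 0) ⟩
    h 0 + sumTo h n   ∎)

sumTo-pairs : ∀ (h : ℕ → ℕ) x → sumTo h (x * 2) ≡ sumTo (λ t → h (t * 2) + h (suc (t * 2))) x
sumTo-pairs h zero    = refl
sumTo-pairs h (suc x) = trans (sym (+-assoc (h 0) (h 1) _)) (cong (h 0 + h 1 +_) (sumTo-pairs (h ∘ suc ∘ suc) x))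

gauss : ∀ n → 2 * sumTo suc n ≡ n * suc n
gauss zero    = refl
gauss (suc n) = begin
    2 * sumTo suc (suc n)      ≡⟨ cong (2 *_) (sumTo-snoc suc n) ⟩
    2 * (sumTo suc n + suc n)  ≡⟨ *-distribˡ-+ 2 (sumTo suc n) (suc n) ⟩
    2 * sumTo suc n + 2 * suc n ≡⟨ cong (_+ 2 * suc n) (gauss n) ⟩
    n * suc n + 2 * suc n      ≡⟨ step n ⟩
    suc n * suc (suc n)        ∎
  where
  open ≡-Reasoning
  step : ∀ n → n * suc n + 2 * suc n ≡ suc n * suc (suc n)
  step = solve-∀

maxTo-upper : ∀ (h : ℕ → ℕ) k i → i < k → h i ≤ maxTo h k
maxTo-upper h (suc k) zero    _         = m≤m⊔n (h 0) _
maxTo-upper h (suc k) (suc i) (s≤s i<k) = ≤-trans (maxTo-upper (h ∘ suc) k i i<k) (m≤n⊔m (h 0) _)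

maxTo-least : ∀ (h : ℕ → ℕ) k B → (∀ i → i < k → h i ≤ B) → maxTo h k ≤ B
maxTo-least h zero    B h≤B = z≤n
maxTo-least h (suc k) B h≤B =
  ⊔-lub (h≤B 0 (s≤s z≤n)) (maxTo-least (h ∘ suc) k B (λ i i<k → h≤B (suc i) (s≤s i<k)))

sumTo-≤ : ∀ (h : ℕ → ℕ) k B → (∀ i → i < k → h i ≤ B) → sumTo h k ≤ k * B
sumTo-≤ h zero    B h≤B = z≤n
sumTo-≤ h (suc k) B h≤B =
  +-mono-≤ (h≤B 0 (s≤s z≤n)) (sumTo-≤ (h ∘ suc) k B (λ i i<k → h≤B (suc i) (s≤s i<k)))

sumTo-< : ∀ (h : ℕ → ℕ) k B → (∀ i → i < k → h i ≤ B) → ∀ j → j < k → h j < B → sumTo h k < k * B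
sumTo-< h (suc k) B h≤B zero    _         hj<B =
  +-mono-<-≤ hj<B (sumTo-≤ (h ∘ suc) k B (λ i i<k → h≤B (suc i) (s≤s i<k)))
sumTo-< h (suc k) B h≤B (suc j) (s≤s j<k) hj<B =
  +-mono-≤-< (h≤B 0 (s≤s z≤n)) (sumTo-< (h ∘ suc) k B (λ i i<k → h≤B (suc i) (s≤s i<k)) j j<k hj<B)

sumTo-saturated : ∀ (h : ℕ → ℕ) k B → (∀ i → i < k → h i ≤ B) → k * B ≤ sumTo h k →
                  ∀ j → j < k → h j ≡ B
sumTo-saturated h k B h≤B kB≤Σ j j<k with m≤n⇒m<n∨m≡n (h≤B j j<k)
... | inj₂ hj≡B = hj≡B
... | inj₁ hj<B = ⊥-elim (<⇒≱ (sumTo-< h k B h≤B j j<k hj<B) kB≤Σ)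

toℕ-mod : ∀ x N .{{_ : NonZero N}} → toℕ (x mod N) ≡ x % N
toℕ-mod x N = FinP.toℕ-fromℕ< (m%n<n x N)

mod-cong : ∀ x y N .{{_ : NonZero N}} → x % N ≡ y % N → x mod N ≡ y mod N
mod-cong x y N eq = FinP.toℕ-injective (trans (toℕ-mod x N) (trans eq (sym (toℕ-mod y N))))

val-mod : ∀ n′ (π : Permutation′ (suc n′)) x y → x % suc n′ ≡ y % suc n′ →
          val (suc n′) π x ≡ val (suc n′) π y
val-mod n′ π x y eq = cong (λ z → suc (toℕ (π ⟨$⟩ʳ z))) (mod-cong x y (suc n′) eq)

val-periodic : ∀ n′ (π : Permutation′ (suc n′)) x → val (suc n′) π (x + suc n′) ≡ val (suc n′) π x
val-periodic n′ π x = val-mod n′ π (x + suc n′) x ([m+n]%n≡m%n x (suc n′))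

val-injective : ∀ n′ (π : Permutation′ (suc n′)) x y → val (suc n′) π x ≡ val (suc n′) π y →
                x % suc n′ ≡ y % suc n′
val-injective n′ π x y eq = begin
    x % N                         ≡⟨ toℕ-mod x N ⟨
    toℕ (x mod N)                 ≡⟨ cong toℕ (sym (inverseˡ π)) ⟩
    toℕ (π ⟨$⟩ˡ (π ⟨$⟩ʳ (x mod N))) ≡⟨ cong (λ z → toℕ (π ⟨$⟩ˡ z)) (FinP.toℕ-injective (suc-injective eq)) ⟩
    toℕ (π ⟨$⟩ˡ (π ⟨$⟩ʳ (y mod N))) ≡⟨ cong toℕ (inverseˡ π) ⟩
    toℕ (y mod N)                 ≡⟨ toℕ-mod y N ⟩
    y % N                         ∎
  where
  open ≡-Reasoning
  N = suc n′

windowSum-sumTo : ∀ n k π i → windowSum n k π i ≡ sumTo (λ j → val n π (i + j)) k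
windowSum-sumTo n k π i = sum-applyUpTo (λ j → val n π (i + j)) id k

maxWindow-maxTo : ∀ n k π → maxWindow n k π ≡ maxTo (windowSum n k π) n
maxWindow-maxTo n k π = max-applyUpTo (windowSum n k π) id n

val-sum : ∀ n′ (π : Permutation′ (suc n′)) → sumTo (val (suc n′) π) (suc n′) ≡ sumTo suc (suc n′)
val-sum n′ π = begin
    sumTo (val N π) N                               ≡⟨ asFinSum (val N π) N ⟩
    S.sum (λ (x : Fin N) → val N π (toℕ x))         ≡⟨ S.sum-cong-≗ {N} (λ x → cong (λ z → suc (toℕ (π ⟨$⟩ʳ z))) (toℕ-mod-self x)) ⟩
    S.sum (λ (x : Fin N) → suc (toℕ (π ⟨$⟩ʳ x)))    ≡⟨ S.sum-permute (λ y → suc (toℕ y)) π ⟨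
    S.sum (λ (y : Fin N) → suc (toℕ y))             ≡⟨ asFinSum suc N ⟨
    sumTo suc N                                     ∎
  where
  open ≡-Reasoning
  module S = MonoidSum +-0-commutativeMonoid
  N = suc n′
  asFinSum : ∀ (h : ℕ → ℕ) n → sumTo h n ≡ S.sum (λ (x : Fin n) → h (toℕ x))
  asFinSum h zero    = refl
  asFinSum h (suc n) = cong (h 0 +_) (asFinSum (h ∘ suc) n)
  toℕ-mod-self : (x : Fin N) → toℕ x mod N ≡ x
  toℕ-mod-self x = FinP.toℕ-injective (trans (toℕ-mod (toℕ x) N) (m<n⇒m%n≡m (FinP.toℕ<n x)))

window-slide : ∀ n k π i → windowSum n k π i + val n π (i + k) ≡ val n π i + windowSum n k π (suc i)
window-slide n k π i = begin
    windowSum n k π i + val n π (i + k)        ≡⟨ cong (_+ val n π (i + k)) (windowSum-sumTo n k π i) ⟩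
    sumTo h k + h k                            ≡⟨ sumTo-snoc h k ⟨
    h 0 + sumTo (h ∘ suc) k                    ≡⟨ cong₂ _+_ (cong (val n π) (+-identityʳ i))
                                                            (sumTo-cong k (λ j _ → cong (val n π) (+-suc i j))) ⟩
    val n π i + sumTo (λ j → val n π (suc i + j)) k ≡⟨ cong (val n π i +_) (windowSum-sumTo n k π (suc i)) ⟨
    val n π i + windowSum n k π (suc i)        ∎
  where
  open ≡-Reasoning
  h : ℕ → ℕ
  h j = val n π (i + j)

-- Every value lies in exactly k windows: Σ_i s_i = k(1 + … + n).
windows-total : ∀ n′ k (π : Permutation′ (suc n′)) →
                sumTo (windowSum (suc n′) k π) (suc n′) ≡ k * sumTo suc (suc n′)
windows-total n′ k π = begin
    sumTo (windowSum N k π) N                         ≡⟨ sumTo-cong N (λ i _ → windowSum-sumTo N k π i) ⟩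
    sumTo (λ i → sumTo (λ j → val N π (i + j)) k) N   ≡⟨ sumTo-swap (λ i j → val N π (i + j)) N k ⟩
    sumTo (λ j → sumTo (λ i → val N π (i + j)) N) k   ≡⟨ sumTo-cong k (λ j _ → trans (sumTo-periodic (val N π) N (val-periodic n′ π) j)
                                                                                     (val-sum n′ π)) ⟩
    sumTo (λ _ → sumTo suc N) k                       ≡⟨ sumTo-const (sumTo suc N) k ⟩
    k * sumTo suc N                                   ∎
  where
  open ≡-Reasoning
  N = suc n′

maxWindow-lower : ∀ n′ k (π : Permutation′ (suc n′)) T → 0 < k → k < suc n′ →
                  k * (suc n′ + 1) ≡ T * 2 → T < maxWindow (suc n′) k π
maxWindow-lower n′ k π T 0<k k<N kN+k≡2T = ≰⇒> (λ max≤T → <⇒≢ 0<k (sym (k≡0 max≤T)))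
  where
  N = suc n′
  total : N * T ≡ sumTo (windowSum N k π) N
  total = sym (*-cancelʳ-≡ _ _ 2 (begin
      sumTo (windowSum N k π) N * 2 ≡⟨ cong (_* 2) (windows-total n′ k π) ⟩
      k * sumTo suc N * 2           ≡⟨ reassoc k (sumTo suc N) ⟩
      k * (2 * sumTo suc N)         ≡⟨ cong (k *_) (gauss N) ⟩
      k * (N * suc N)               ≡⟨ exchange k N ⟩
      N * (k * (N + 1))             ≡⟨ cong (N *_) kN+k≡2T ⟩
      N * (T * 2)                   ≡⟨ *-assoc N T 2 ⟨
      N * T * 2                     ∎))
    where
    open ≡-Reasoning
    reassoc : ∀ k S → k * S * 2 ≡ k * (2 * S)
    reassoc = solve-∀
    exchange : ∀ k N → k * (N * suc N) ≡ N * (k * (N + 1))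
    exchange = solve-∀
  -- If no window exceeds T then all windows equal T, so π_k = π_0.
  k≡0 : maxWindow N k π ≤ T → k ≡ 0
  k≡0 max≤T = begin
      k       ≡⟨ m<n⇒m%n≡m k<N ⟨
      k % N   ≡⟨ val-injective n′ π k 0 πk≡π0 ⟩
      0 % N   ≡⟨⟩
      0       ∎
    where
    open ≡-Reasoning
    s≤T : ∀ i → i < N → windowSum N k π i ≤ T
    s≤T i i<N = ≤-trans (maxTo-upper (windowSum N k π) N i i<N)
                        (≤-trans (≤-reflexive (sym (maxWindow-maxTo N k π))) max≤T)
    s≡T : ∀ i → i < N → windowSum N k π i ≡ T
    s≡T = sumTo-saturated (windowSum N k π) N T s≤T (≤-reflexive total)
    πk≡π0 : val N π k ≡ val N π 0
    πk≡π0 = +-cancelˡ-≡ T _ _ (begin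
        T + val N π k                         ≡⟨ cong (_+ val N π k) (s≡T 0 (s≤s z≤n)) ⟨
        windowSum N k π 0 + val N π (0 + k)   ≡⟨ window-slide N k π 0 ⟩
        val N π 0 + windowSum N k π 1         ≡⟨ cong (val N π 0 +_) (s≡T 1 (≤-trans (s≤s 0<k) k<N)) ⟩
        val N π 0 + T                         ≡⟨ +-comm (val N π 0) T ⟩
        T + val N π 0                         ∎)

even-or-odd : ∀ i → Σ ℕ (λ J → i ≡ J * 2 ⊎ i ≡ suc (J * 2))
even-or-odd zero = 0 , inj₁ refl
even-or-odd (suc i) with even-or-odd i
... | J , inj₁ i≡2J  = J , inj₂ (cong suc i≡2J)
... | J , inj₂ i≡2J+1 = suc J , inj₁ (cong suc i≡2J+1)

paired-upper : ∀ n (π : Permutation′ n) d c →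
               (∀ J → val n π (J * 2) + val n π (suc (J * 2)) ≡ c) →
               (∀ J → val n π ((J + d) * 2) ≤ suc (val n π (J * 2))) →
               maxWindow n (d * 2) π ≤ suc (d * c)
paired-upper n π d c pair step =
  ≤-trans (≤-reflexive (maxWindow-maxTo n (d * 2) π)) (maxTo-least _ n (suc (d * c)) (λ i _ → window≤ i))
  where
  T = d * c
  even-window : ∀ J → windowSum n (d * 2) π (J * 2) ≡ T
  even-window J = begin
      windowSum n (d * 2) π (J * 2)                       ≡⟨ windowSum-sumTo n (d * 2) π (J * 2) ⟩
      sumTo h (d * 2)                                     ≡⟨ sumTo-pairs h d ⟩
      sumTo (λ t → h (t * 2) + h (suc (t * 2))) d         ≡⟨ sumTo-cong d (λ t _ → trans (cong₂ _+_ (cong (val n π) (even t))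
                                                                                                    (cong (val n π) (odd t)))
                                                                                         (pair (J + t))) ⟩
      sumTo (λ _ → c) d                                   ≡⟨ sumTo-const c d ⟩
      T                                                   ∎
    where
    open ≡-Reasoning
    h : ℕ → ℕ
    h t = val n π (J * 2 + t)
    even : ∀ t → J * 2 + t * 2 ≡ (J + t) * 2
    even t = sym (*-distribʳ-+ 2 J t)
    odd : ∀ t → J * 2 + suc (t * 2) ≡ suc ((J + t) * 2)
    odd t = trans (+-suc (J * 2) (t * 2)) (cong suc (even t))
  odd-window : ∀ J → windowSum n (d * 2) π (suc (J * 2)) ≤ suc T
  odd-window J = +-cancelˡ-≤ (val n π (J * 2)) _ _ (begin
      val n π (J * 2) + windowSum n (d * 2) π (suc (J * 2))   ≡⟨ window-slide n (d * 2) π (J * 2) ⟨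
      windowSum n (d * 2) π (J * 2) + val n π (J * 2 + d * 2) ≡⟨ cong₂ _+_ (even-window J) (cong (val n π) (sym (*-distribʳ-+ 2 J d))) ⟩
      T + val n π ((J + d) * 2)                               ≤⟨ +-monoʳ-≤ T (step J) ⟩
      T + suc (val n π (J * 2))                               ≡⟨ shuffle T (val n π (J * 2)) ⟩
      val n π (J * 2) + suc T                                 ∎)
    where
    open ≤-Reasoning
    shuffle : ∀ T v → T + suc v ≡ v + suc T
    shuffle = solve-∀
  window≤ : ∀ i → windowSum n (d * 2) π i ≤ suc T
  window≤ i with even-or-odd i
  ... | J , inj₁ refl = ≤-trans (≤-reflexive (even-window J)) (n≤1+n T)
  ... | J , inj₂ refl = odd-window J

/1-mono-≤ : ∀ a b → a ≤ b → (ℤ.+ a) ℚ./ 1 ℚ.≤ (ℤ.+ b) ℚ./ 1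
/1-mono-≤ a b a≤b = ℚP.toℚᵘ-cancel-≤
  (ℚᵘP.≤-respˡ-≃ (ℚᵘP.≃-sym (ℚP.toℚᵘ-fromℚᵘ (mkℚᵘ (ℤ.+ a) 0)))
    (ℚᵘP.≤-respʳ-≃ (ℚᵘP.≃-sym (ℚP.toℚᵘ-fromℚᵘ (mkℚᵘ (ℤ.+ b) 0)))
      (ℚᵘ.*≤* (subst₂ ℤ._≤_ (sym (ℤP.*-identityʳ (ℤ.+ a))) (sym (ℤP.*-identityʳ (ℤ.+ b))) (ℤ.+≤+ a≤b)))))

succ-minus-half : ∀ T → ((ℤ.+ suc T) ℚ./ 1) ℚ.- ((ℤ.+ (T * 2)) ℚ./ 2) ≡ 1ℚ
succ-minus-half T = ℚP.toℚᵘ-injective (ℚᵘP.≃-trans (ℚP.toℚᵘ-homo-+ p (ℚ.- q))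
  (ℚᵘP.≃-trans (ℚᵘP.+-cong (ℚP.toℚᵘ-fromℚᵘ (mkℚᵘ (ℤ.+ suc T) 0))
                           (ℚᵘP.≃-trans (ℚP.toℚᵘ-homo‿- q) (ℚᵘP.-‿cong (ℚP.toℚᵘ-fromℚᵘ (mkℚᵘ (ℤ.+ (T * 2)) 1)))))
               (ℚᵘ.*≡* cross-multiplied)))
  where
  p = (ℤ.+ suc T) ℚ./ 1
  q = (ℤ.+ (T * 2)) ℚ./ 2
  identity : ∀ (x : ℤ.ℤ) → ((ℤ.+ 1 ℤ.+ x) ℤ.* ℤ.+ 2 ℤ.+ ℤ.- (x ℤ.* ℤ.+ 2) ℤ.* ℤ.+ 1) ℤ.* ℤ.+ 1 ≡ ℤ.+ 1 ℤ.* (ℤ.+ 1 ℤ.* ℤ.+ 2)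
  identity = ℤSolver.solve-∀
  cross-multiplied : (ℤ.+ suc T ℤ.* ℤ.+ 2 ℤ.+ ℤ.- (ℤ.+ (T * 2)) ℤ.* ℤ.+ 1) ℤ.* ℤ.+ 1 ≡ ℤ.+ 1 ℤ.* (ℤ.+ 1 ℤ.* ℤ.+ 2)
  cross-multiplied rewrite ℤP.pos-+ 1 T | ℤP.pos-* T 2 = identity (ℤ.+ T)

msum-exact : ∀ n k π T → k * (n + 1) ≡ T * 2 → maxWindow n k π ≡ suc T → msumπ n k π ≡ 1ℚ
msum-exact n k π T k[n+1]≡2T max≡T+1 =
  trans (cong₂ (λ a b → ((ℤ.+ a) ℚ./ 1) ℚ.- ((ℤ.+ b) ℚ./ 2)) max≡T+1 k[n+1]≡2T) (succ-minus-half T)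

msum-lower : ∀ n k π T → k * (n + 1) ≡ T * 2 → T < maxWindow n k π → 1ℚ ℚ.≤ msumπ n k π
msum-lower n k π T k[n+1]≡2T T<max =
  subst₂ ℚ._≤_ (succ-minus-half T) (cong (λ b → ((ℤ.+ maxWindow n k π) ℚ./ 1) ℚ.- ((ℤ.+ b) ℚ./ 2)) (sym k[n+1]≡2T))
    (ℚP.+-monoˡ-≤ (ℚ.- ((ℤ.+ (T * 2)) ℚ./ 2)) (/1-mono-≤ (suc T) (maxWindow n k π) T<max))

%-absorbˡ : ∀ a b m .{{_ : NonZero m}} → (a % m + b) % m ≡ (a + b) % m
%-absorbˡ a b m = begin
    (a % m + b) % m         ≡⟨ %-distribˡ-+ (a % m) b m ⟩
    (a % m % m + b % m) % m ≡⟨ cong (λ z → (z + b % m) % m) (m%n%n≡m%n a m) ⟩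
    (a % m + b % m) % m     ≡⟨ %-distribˡ-+ a b m ⟨
    (a + b) % m             ∎
  where open ≡-Reasoning

+-%-cancel : ∀ a b m .{{_ : NonZero m}} → (a + b) % m ≡ a % m → m ∣ b
+-%-cancel a b m eq = ∣m+n∣m⇒∣n {m} {(a / m) * m} {b} m∣[a/m]m+b (n∣m*n (a / m))
  where
  m∣[a/m]m+b : m ∣ (a / m) * m + b
  m∣[a/m]m+b = divides ((a + b) / m) (+-cancelˡ-≡ (a % m) _ _ (begin
      a % m + ((a / m) * m + b) ≡⟨ +-assoc (a % m) _ b ⟨
      a % m + (a / m) * m + b   ≡⟨ cong (_+ b) (m≡m%n+[m/n]*n a m) ⟨
      a + b                     ≡⟨ m≡m%n+[m/n]*n (a + b) m ⟩
      (a + b) % m + ((a + b) / m) * m ≡⟨ cong (_+ ((a + b) / m) * m) eq ⟩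
      a % m + ((a + b) / m) * m ∎))
    where open ≡-Reasoning

∣∧<⇒≡0 : ∀ L s → L ∣ s → s < L → s ≡ 0
∣∧<⇒≡0 L zero    _   _   = refl
∣∧<⇒≡0 L (suc s) L∣s s<L = ⊥-elim (<⇒≱ s<L (∣⇒≤ L∣s))

-- Let
-- g = gcd(m,d), L = m/g, e = d/g, so gcd(L,e) = 1.  Writing w = rL + t with
-- r < g and t < L, the label φ(w) = (r + t·d) mod m runs, as t runs, through
-- the L residues congruent to r mod g.  Hence φ is a bijection of
-- {0,…,m−1}, and advancing t by one (the successor of w, which is w+1 or
-- wraps back to the start of the block of w) adds d to the label.
module Labelling (m′ d : ℕ) where

  m : ℕ
  m = suc m′

  g : ℕ
  g = gcd m d

  instance
    g-nonZero : NonZero g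
    g-nonZero = ≢-nonZero (gcd[m,n]≢0 m d (inj₁ λ ()))

  L e : ℕ
  L = m / g
  e = d / g

  m≡gL : m ≡ g * L
  m≡gL = sym (m*[n/m]≡n (gcd[m,n]∣m m d))

  d≡eg : d ≡ e * g
  d≡eg = sym (m/n*n≡m (gcd[m,n]∣n m d))

  instance
    L-nonZero : NonZero L
    L-nonZero = ≢-nonZero (λ L≡0 → 0≢1+n (sym (trans m≡gL (trans (cong (g *_) L≡0) (*-zeroʳ g)))))

  L⊥e : Coprime L e
  L⊥e = coprime-/gcd m d

  φ : ℕ → ℕ
  φ w = (w / L + w * d) % m

  -- L·d is a multiple of m, so the multiplier of d matters only mod L.
  mod-L : ∀ a x → (a + x * d) % m ≡ (a + (x % L) * d) % m
  mod-L a x = begin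
      (a + x * d) % m                           ≡⟨ cong (λ z → (a + z * d) % m) (m≡m%n+[m/n]*n x L) ⟩
      (a + (x % L + (x / L) * L) * d) % m       ≡⟨ cong (_% m) (expand a (x % L) (x / L) L d) ⟩
      (a + (x % L) * d + (x / L) * (L * d)) % m ≡⟨ %-remove-+ʳ (a + (x % L) * d) m∣Ld ⟩
      (a + (x % L) * d) % m                     ∎
    where
    open ≡-Reasoning
    expand : ∀ a t q L d → a + (t + q * L) * d ≡ a + t * d + q * (L * d)
    expand = solve-∀
    swap : ∀ L e g → L * (e * g) ≡ e * (g * L)
    swap = solve-∀
    m∣Ld : m ∣ (x / L) * (L * d)
    m∣Ld = ∣-trans (divides e (trans (cong (L *_) d≡eg) (trans (swap L e g) (cong (e *_) (sym m≡gL)))))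
                   (n∣m*n (x / L))

  φ<m : ∀ w → φ w < m
  φ<m w = m%n<n (w / L + w * d) m

  block<g : ∀ w → w < m → w / L < g
  block<g w w<m = m<n*o⇒m/o<n (subst (w <_) m≡gL w<m)

  -- φ(w) ≡ ⌊w/L⌋ (mod g), since g divides both m and d.
  φ-mod-g : ∀ w → φ w % g ≡ (w / L) % g
  φ-mod-g w = begin
      φ w % g                     ≡⟨ m∣n⇒o%n%m≡o%m g m (w / L + w * d) g∣m ⟩
      (w / L + w * d) % g         ≡⟨ cong (λ z → (w / L + z) % g) (trans (cong (w *_) d≡eg) (sym (*-assoc w e g))) ⟩
      (w / L + w * e * g) % g     ≡⟨ [m+kn]%n≡m%n (w / L) (w * e) g ⟩
      (w / L) % g                 ∎
    where
    open ≡-Reasoning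
    g∣m : g ∣ m
    g∣m = divides L (trans m≡gL (*-comm g L))

  -- Equal labels force equal blocks ⌊w/L⌋ …
  φ-block : ∀ w w′ → w < m → w′ < m → φ w ≡ φ w′ → w / L ≡ w′ / L
  φ-block w w′ w<m w′<m eq = begin
      w / L        ≡⟨ m<n⇒m%n≡m (block<g w w<m) ⟨
      (w / L) % g  ≡⟨ φ-mod-g w ⟨
      φ w % g      ≡⟨ cong (_% g) eq ⟩
      φ w′ % g     ≡⟨ φ-mod-g w′ ⟩
      (w′ / L) % g ≡⟨ m<n⇒m%n≡m (block<g w′ w′<m) ⟩
      w′ / L       ∎
    where open ≡-Reasoning

  -- … and, since d·s ≡ 0 (mod m) forces L ∣ s, equal offsets within a block.
  offset-injective : ∀ r t t′ → t′ ≤ t → t < L → (r + t * d) % m ≡ (r + t′ * d) % m → t ≡ t′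
  offset-injective r t t′ t′≤t t<L eq =
    trans (sym (m+[n∸m]≡n t′≤t)) (trans (cong (t′ +_) s≡0) (+-identityʳ t′))
    where
    s = t ∸ t′
    split : ∀ r t′ s d → r + t′ * d + s * d ≡ r + (t′ + s) * d
    split = solve-∀
    m∣sd : m ∣ s * d
    m∣sd = +-%-cancel (r + t′ * d) (s * d) m
             (trans (cong (_% m) (split r t′ s d)) (trans (cong (λ z → (r + z * d) % m) (m+[n∸m]≡n t′≤t)) eq))
    L∣se : L ∣ s * e
    L∣se = *-cancelʳ-∣ g (subst₂ _∣_ (trans m≡gL (*-comm g L)) (trans (cong (s *_) d≡eg) (sym (*-assoc s e g))) m∣sd)
    s≡0 : s ≡ 0
    s≡0 = ∣∧<⇒≡0 L s (coprime-divisor L⊥e (subst (L ∣_) (*-comm s e) L∣se)) (≤-<-trans (m∸n≤m t t′) t<L)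

  φ-injective : ∀ w w′ → w < m → w′ < m → φ w ≡ φ w′ → w ≡ w′
  φ-injective w w′ w<m w′<m eq = begin
      w                     ≡⟨ m≡m%n+[m/n]*n w L ⟩
      w % L + (w / L) * L   ≡⟨ cong₂ (λ a b → a + b * L) same-offset same-block ⟩
      w′ % L + (w′ / L) * L ≡⟨ m≡m%n+[m/n]*n w′ L ⟨
      w′                    ∎
    where
    open ≡-Reasoning
    same-block = φ-block w w′ w<m w′<m eq
    eq′ : (w / L + (w % L) * d) % m ≡ (w / L + (w′ % L) * d) % m
    eq′ = trans (sym (mod-L (w / L) w))
            (trans eq (trans (mod-L (w′ / L) w′) (cong (λ z → (z + (w′ % L) * d) % m) (sym same-block))))
    same-offset : w % L ≡ w′ % L
    same-offset with ≤-total (w′ % L) (w % L)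
    ... | inj₁ le = offset-injective (w / L) (w % L) (w′ % L) le (m%n<n w L) eq′
    ... | inj₂ le = sym (offset-injective (w / L) (w′ % L) (w % L) le (m%n<n w′ L) (sym eq′))

  -- The successor of w inside its block of length L (cyclically).
  succ : ℕ → ℕ
  succ w = suc (w % L) % L + (w / L) * L

  succ≤ : ∀ w → succ w ≤ suc w
  succ≤ w = begin
      suc (w % L) % L + (w / L) * L ≤⟨ +-monoˡ-≤ _ (m%n≤m (suc (w % L)) L) ⟩
      suc (w % L) + (w / L) * L     ≡⟨ cong suc (m≡m%n+[m/n]*n w L) ⟨
      suc w                         ∎
    where open ≤-Reasoning

  succ<m : ∀ w → w < m → succ w < m
  succ<m w w<m = begin-strict
      suc (w % L) % L + (w / L) * L <⟨ +-monoˡ-< _ (m%n<n (suc (w % L)) L) ⟩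
      suc (w / L) * L               ≤⟨ *-monoˡ-≤ L (block<g w w<m) ⟩
      g * L                         ≡⟨ m≡gL ⟨
      m                             ∎
    where open ≤-Reasoning

  φ-succ : ∀ w → φ (succ w) ≡ (φ w + d) % m
  φ-succ w = begin
      (succ w / L + succ w * d) % m         ≡⟨ mod-L (succ w / L) (succ w) ⟩
      (succ w / L + (succ w % L) * d) % m   ≡⟨ cong₂ (λ a b → (a + b * d) % m) same-block same-offset ⟩
      (w / L + (suc w % L) * d) % m         ≡⟨ mod-L (w / L) (suc w) ⟨
      (w / L + suc w * d) % m               ≡⟨ cong (_% m) (unfold (w / L) w d) ⟩
      (w / L + w * d + d) % m               ≡⟨ %-absorbˡ (w / L + w * d) d m ⟨
      (φ w + d) % m                         ∎
    where
    open ≡-Reasoning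
    unfold : ∀ a w d → a + suc w * d ≡ a + w * d + d
    unfold = solve-∀
    same-block : succ w / L ≡ w / L
    same-block = begin
        (suc (w % L) % L + (w / L) * L) / L       ≡⟨ +-distrib-/-∣ʳ (suc (w % L) % L) (n∣m*n (w / L)) ⟩
        suc (w % L) % L / L + (w / L) * L / L     ≡⟨ cong₂ _+_ (m<n⇒m/n≡0 (m%n<n (suc (w % L)) L)) (m*n/n≡m (w / L) L) ⟩
        w / L                                     ∎
    same-offset : succ w % L ≡ suc w % L
    same-offset = begin
        (suc (w % L) % L + (w / L) * L) % L ≡⟨ [m+kn]%n≡m%n (suc (w % L) % L) (w / L) L ⟩
        suc (w % L) % L % L                 ≡⟨ m%n%n≡m%n (suc (w % L)) L ⟩
        suc (w % L) % L                     ≡⟨ [m+kn]%n≡m%n (suc (w % L)) (w / L) L ⟨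
        (suc (w % L) + (w / L) * L) % L     ≡⟨ cong (λ z → suc z % L) (m≡m%n+[m/n]*n w L) ⟨
        suc w % L                           ∎

injective⇒onto : ∀ n (f : Fin n → Fin n) → (∀ x y → f x ≡ f y → x ≡ y) → ∀ y → ∃ λ x → f x ≡ y
injective⇒onto n f f-inj y with FinP.any? (λ x → f x Fin.≟ y)
... | yes hit = hit
injective⇒onto (suc n) f f-inj y | no miss = ⊥-elim (<-irrefl refl (FinP.injective⇒≤ {f = avoid} avoid-inj))
  where
  -- f misses y, so f squeezes Fin (suc n) injectively into Fin n.
  y≢f : ∀ x → y ≢ f x
  y≢f x eq = miss (x , sym eq)
  avoid : Fin (suc n) → Fin n
  avoid x = Fin.punchOut (y≢f x)
  avoid-inj : ∀ {x x′} → avoid x ≡ avoid x′ → x ≡ x′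
  avoid-inj {x} {x′} eq = f-inj x x′ (FinP.punchOut-injective (y≢f x) (y≢f x′) eq)

-- A map F on ℕ injecting {0,…,n−1} into itself is the position map of a
-- permutation π of {1,…,n}: the value π_y = index y + 1 sits at position
-- F (index y) ≡ y (mod n).
module FromPositions (n′ : ℕ) (F : ℕ → ℕ)
         (F<n : ∀ w → w < suc n′ → F w < suc n′)
         (F-inj : ∀ w w′ → w < suc n′ → w′ < suc n′ → F w ≡ F w′ → w ≡ w′) where

  n : ℕ
  n = suc n′

  F↾ : Fin n → Fin n
  F↾ x = Fin.fromℕ< (F<n (toℕ x) (FinP.toℕ<n x))

  toℕ-F↾ : ∀ x → toℕ (F↾ x) ≡ F (toℕ x)
  toℕ-F↾ x = FinP.toℕ-fromℕ< _

  F↾-inj : ∀ x y → F↾ x ≡ F↾ y → x ≡ y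
  F↾-inj x y eq = FinP.toℕ-injective (F-inj _ _ (FinP.toℕ<n x) (FinP.toℕ<n y)
                    (trans (sym (toℕ-F↾ x)) (trans (cong toℕ eq) (toℕ-F↾ y))))

  F↾⁻¹ : Fin n → Fin n
  F↾⁻¹ y = proj₁ (injective⇒onto n F↾ F↾-inj y)

  F↾∘F↾⁻¹ : ∀ y → F↾ (F↾⁻¹ y) ≡ y
  F↾∘F↾⁻¹ y = proj₂ (injective⇒onto n F↾ F↾-inj y)

  -- π is kept abstract: only its defining property is used, and unfolding
  -- the pigeonhole inverse during type checking is expensive.
  abstract
    π : Permutation′ n
    π = permutation F↾⁻¹ F↾ (λ x → F↾-inj _ _ (F↾∘F↾⁻¹ (F↾ x))) F↾∘F↾⁻¹

    F↾∘π : ∀ y → F↾ (π ⟨$⟩ʳ y) ≡ y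
    F↾∘π = F↾∘F↾⁻¹

  index : ℕ → ℕ
  index y = toℕ (π ⟨$⟩ʳ (y mod n))

  index<n : ∀ y → index y < n
  index<n y = FinP.toℕ<n (π ⟨$⟩ʳ (y mod n))

  F∘index : ∀ y → F (index y) ≡ y % n
  F∘index y = trans (sym (toℕ-F↾ (π ⟨$⟩ʳ (y mod n)))) (trans (cong toℕ (F↾∘π (y mod n))) (toℕ-mod y n))

  index∘F : ∀ w → w < n → index (F w) ≡ w
  index∘F w w<n = F-inj _ _ (index<n (F w)) w<n (trans (F∘index (F w)) (m<n⇒m%n≡m (F<n w w<n)))

-- even≢odd with the factor 2 on the right, as positions are written.
even≢odd′ : ∀ a b → a * 2 ≢ suc (b * 2)
even≢odd′ a b eq = even≢odd a b (trans (*-comm 2 a) (trans eq (cong suc (*-comm b 2))))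

-- Value index w < m is placed at position 2φ(w); its complement 2m−1−w at
-- position 2φ(w)+1.  Hence each pair (2c, 2c+1) carries values summing to
-- 2m+1, and the value at 2(c+d) exceeds the value at 2c by at most one.
module Interleaved (m′ d : ℕ) where

  open Labelling m′ d

  N : ℕ
  N = m * 2

  position : ℕ → ℕ
  position w with w <? m
  ... | yes _ = φ w * 2
  ... | no _  = suc (φ (N ∸ suc w) * 2)

  position-low : ∀ w → w < m → position w ≡ φ w * 2
  position-low w w<m with w <? m
  ... | yes _   = refl
  ... | no w≮m = ⊥-elim (w≮m w<m)

  position-high : ∀ w → ¬ w < m → position w ≡ suc (φ (N ∸ suc w) * 2)
  position-high w w≮m with w <? m
  ... | yes w<m = ⊥-elim (w≮m w<m)
  ... | no _    = refl

  even<N : ∀ c → c < m → c * 2 < N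
  even<N c c<m = <-trans (n<1+n (c * 2)) (*-monoˡ-≤ 2 c<m)

  odd<N : ∀ c → c < m → suc (c * 2) < N
  odd<N c c<m = *-monoˡ-≤ 2 c<m

  mirror<m : ∀ w → ¬ w < m → w < N → N ∸ suc w < m
  mirror<m w w≮m w<N = +-cancelʳ-< (suc w) _ _ (begin
      suc (N ∸ suc w + suc w) ≡⟨ cong suc (m∸n+n≡m w<N) ⟩
      suc (m * 2)             ≡⟨ cong suc (double m) ⟩
      suc (m + m)             ≤⟨ s≤s (+-monoʳ-≤ m (≮⇒≥ w≮m)) ⟩
      suc (m + w)             ≡⟨ +-suc m w ⟨
      m + suc w               ∎)
    where
    open ≤-Reasoning
    double : ∀ m → m * 2 ≡ m + m
    double = solve-∀

  position<N : ∀ w → w < N → position w < N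
  position<N w w<N with w <? m
  ... | yes _ = even<N (φ w) (φ<m w)
  ... | no _  = odd<N (φ (N ∸ suc w)) (φ<m _)

  position-injective : ∀ w w′ → w < N → w′ < N → position w ≡ position w′ → w ≡ w′
  position-injective w w′ w<N w′<N eq with w <? m | w′ <? m
  ... | yes w<m | yes w′<m = φ-injective w w′ w<m w′<m (*-cancelʳ-≡ _ _ 2 eq)
  ... | yes _   | no _     = ⊥-elim (even≢odd′ (φ w) (φ (N ∸ suc w′)) eq)
  ... | no _    | yes _    = ⊥-elim (even≢odd′ (φ w′) (φ (N ∸ suc w)) (sym eq))
  ... | no w≮m  | no w′≮m  = suc-injective (∸-cancelˡ-≡ w<N w′<N
          (φ-injective _ _ (mirror<m w w≮m w<N) (mirror<m w′ w′≮m w′<N) (*-cancelʳ-≡ _ _ 2 (suc-injective eq))))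

  open FromPositions (suc (m′ * 2)) position position<N position-injective
    using (π; index; index<n; F∘index; index∘F) public

  index-mod : ∀ y z → y % N ≡ z % N → index y ≡ index z
  index-mod y z eq = cong (λ x → toℕ (π ⟨$⟩ʳ x)) (mod-cong y z N eq)

  index-even : ∀ J → index (J * 2) ≡ index ((J % m) * 2)
  index-even J = index-mod (J * 2) ((J % m) * 2)
    (trans (sym (m%n*o≡m*o%[n*o] J m 2)) (sym (m<n⇒m%n≡m (even<N (J % m) (m%n<n J m)))))

  index-odd : ∀ J → index (suc (J * 2)) ≡ index (suc ((J % m) * 2))
  index-odd J = index-mod (suc (J * 2)) (suc ((J % m) * 2)) (begin
      suc (J * 2) % N                   ≡⟨ cong (_% N) (+-comm 1 (J * 2)) ⟩
      (J * 2 + 1) % N                   ≡⟨ %-absorbˡ (J * 2) 1 N ⟨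
      (J * 2 % N + 1) % N               ≡⟨ cong (λ z → (z + 1) % N) (m%n*o≡m*o%[n*o] J m 2) ⟨
      ((J % m) * 2 + 1) % N             ≡⟨ cong (_% N) (+-comm ((J % m) * 2) 1) ⟩
      suc ((J % m) * 2) % N             ∎)
    where open ≡-Reasoning

  at-even : ∀ c → c < m → position (index (c * 2)) ≡ c * 2
  at-even c c<m = trans (F∘index (c * 2)) (m<n⇒m%n≡m (even<N c c<m))

  at-odd : ∀ c → c < m → position (index (suc (c * 2))) ≡ suc (c * 2)
  at-odd c c<m = trans (F∘index (suc (c * 2))) (m<n⇒m%n≡m (odd<N c c<m))

  even-slot : ∀ c → c < m → index (c * 2) < m × φ (index (c * 2)) ≡ c
  even-slot c c<m with index (c * 2) <? m
  ... | yes low = low , *-cancelʳ-≡ (φ w) c 2 (trans (sym (position-low w low)) (at-even c c<m))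
    where w = index (c * 2)
  ... | no high = ⊥-elim (even≢odd′ c (φ (N ∸ suc w)) (trans (sym (at-even c c<m)) (position-high w high)))
    where w = index (c * 2)

  odd-slot : ∀ c → c < m → ¬ index (suc (c * 2)) < m × φ (N ∸ suc (index (suc (c * 2)))) ≡ c
  odd-slot c c<m with index (suc (c * 2)) <? m
  ... | yes low = ⊥-elim (even≢odd′ (φ w) c (trans (sym (position-low w low)) (at-odd c c<m)))
    where w = index (suc (c * 2))
  ... | no high = high , *-cancelʳ-≡ (φ (N ∸ suc w)) c 2 (suc-injective (trans (sym (position-high w high)) (at-odd c c<m)))
    where w = index (suc (c * 2))

  pair-sum : ∀ J → val N π (J * 2) + val N π (suc (J * 2)) ≡ suc N
  pair-sum J = begin
      suc (index (J * 2)) + suc (index (suc (J * 2))) ≡⟨ cong₂ (λ a b → suc a + suc b) (trans (index-even J) complementary) (index-odd J) ⟩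
      suc (N ∸ suc w′) + suc w′                       ≡⟨ cong suc (m∸n+n≡m (index<n (suc (c * 2)))) ⟩
      suc N                                           ∎
    where
    open ≡-Reasoning
    c = J % m
    c<m = m%n<n J m
    w′ = index (suc (c * 2))
    complementary : index (c * 2) ≡ N ∸ suc w′
    complementary = φ-injective _ _ (proj₁ (even-slot c c<m)) (mirror<m w′ (proj₁ (odd-slot c c<m)) (index<n (suc (c * 2))))
                      (trans (proj₂ (even-slot c c<m)) (sym (proj₂ (odd-slot c c<m))))

  step : ∀ J → val N π ((J + d) * 2) ≤ suc (val N π (J * 2))
  step J = s≤s (begin
      index ((J + d) * 2)      ≡⟨ index-mod ((J + d) * 2) (position v) same-position ⟩
      index (position v)       ≡⟨ index∘F v v<N ⟩
      v                        ≤⟨ succ≤ w ⟩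
      suc w                    ≡⟨ cong suc (index-even J) ⟨
      suc (index (J * 2))      ∎)
    where
    open ≤-Reasoning
    c = J % m
    w = index (c * 2)
    w<m = proj₁ (even-slot c (m%n<n J m))
    v = succ w
    v<N : v < N
    v<N = <-≤-trans (succ<m w w<m) (m≤m*n m 2)
    φv : φ v ≡ (J + d) % m
    φv = trans (φ-succ w) (trans (cong (λ z → (z + d) % m) (proj₂ (even-slot c (m%n<n J m)))) (%-absorbˡ J d m))
    same-position : ((J + d) * 2) % N ≡ position v % N
    same-position = begin-equality
        ((J + d) * 2) % N      ≡⟨ m%n*o≡m*o%[n*o] (J + d) m 2 ⟨
        ((J + d) % m) * 2      ≡⟨ cong (_* 2) φv ⟨
        φ v * 2                ≡⟨ position-low v (succ<m w w<m) ⟨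
        position v             ≡⟨ m<n⇒m%n≡m (position<N v v<N) ⟨
        position v % N         ∎

  max-window : maxWindow N (d * 2) π ≤ suc (d * suc N)
  max-window = paired-upper N π d (suc N) pair-sum step

theorem1p2 : (n k : ℕ) → 0 < k → k < n → 2 ∣ n → 2 ∣ k → MsumEq n k 1ℚ
theorem1p2 _ _ ()  _   (divides _ refl)        (divides zero refl)
theorem1p2 _ _ _   ()  (divides zero refl)     (divides (suc _) refl)
theorem1p2 _ _ 0<k k<n (divides (suc m′) refl) (divides d refl) =
  (π , msum-exact N k π T average (≤-antisym max-window (lower π))) ,
  (λ σ → msum-lower N k σ T average (lower σ))
  where
  open Interleaved m′ d using (N; π; max-window)
  k T : ℕ
  k = d * 2
  T = d * suc N
  average : k * (N + 1) ≡ T * 2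
  average = rearrange d N
    where
    rearrange : ∀ d N → d * 2 * (N + 1) ≡ d * suc N * 2
    rearrange = solve-∀
  lower : ∀ σ → T < maxWindow N k σ
  lower σ = maxWindow-lower (suc (m′ * 2)) k σ T 0<k k<n average
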